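{- Let $n\geqslant 5$ be odd and let $P_n^5=\mathrm{Cay}(\mathrm{Sym}_n,\{r_{n-3},r_{n-1},r_n\})$. If $n\geqslant 7$, then $P_n^5$ contains no cycle of length $10$. If $n=5$, then $P_5^5$ contains cycles of length $10$; namely, for every $\pi\in\mathrm{Sym}_5$ the sequence of vertices $\pi,\ \pi r_5,\ \pi r_5 r_4,\ \pi r_5 r_4 r_5,\ \ldots$ obtained by applying $r_5$ and $r_4$ alternately ten times returns to $\pi$ (i.e. $(r_5r_4)^5$ is the identity) and traces a $10$-cycle.
   Context: Permutations $\pi\in\mathrm{Sym}_n$ are written in one-line notation $\pi=[\pi_1\pi_2\ldots\pi_n]$ with $\pi_i=\pi(i)$. For $2\leqslant i\leqslant n$, the prefix-reversal $r_i\in\mathrm{Sym}_n$ acts by right multiplication reversing the first $i$ entries: $[\pi_1\ldots\pi_i\pi_{i+1}\ldots\pi_n]\,r_i=[\pi_i\ldots\pi_1\pi_{i+1}\ldots\pi_n]$. $\mathrm{Cay}(\mathrm{Sym}_n,S)$ denotes the undirected simple Cayley graph with vertex set $\mathrm{Sym}_n$ in which $\pi$ is adjacent to $\pi r$ for $r\in S$. A cycle of length $\ell$ is a closed walk through $\ell$ distinct vertices. -}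

module Defs where

open import Data.Nat using (ℕ; zero; suc; _≤_)
open import Data.List using (List; []; _∷_; _++_; take; drop; reverse; length; applyUpTo)
open import Data.List.Relation.Binary.Permutation.Propositional using (_↭_)
open import Data.List.Relation.Unary.All using (All)
open import Data.List.Relation.Unary.Linked using (Linked)
open import Data.List.Relation.Unary.Unique.Propositional using (Unique)
open import Data.List.Membership.Propositional using (_∈_)
open import Data.Product using (Σ; ∃; _×_)
open import Data.Empty using (⊥)
open import Relation.Binary.PropositionalEquality using (_≡_)

-- A permutation of Sym_n in one-line notation [π₁ π₂ … πₙ], as a list of naturals.
-- Sym n : the list is a rearrangement of [1, 2, …, n].
OneToN : ℕ → List ℕ
OneToN n = applyUpTo suc n

InSym : ℕ → List ℕ → Set
InSym n π = π ↭ OneToN n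

_·r_ : List ℕ → ℕ → List ℕ
π ·r i = reverse (take i π) ++ drop i π

Adj : List ℕ → List ℕ → List ℕ → Set
Adj S π σ = Σ ℕ λ i → i ∈ S × ((σ ≡ π ·r i) Data.Sum.⊎ (π ≡ σ ·r i))
  where import Data.Sum

ClosedWalk : (List ℕ → List ℕ → Set) → List (List ℕ) → Set
ClosedWalk R [] = ⊥
ClosedWalk R (v ∷ vs) = Linked R ((v ∷ vs) ++ (v ∷ []))

IsCycle : ℕ → List ℕ → ℕ → List (List ℕ) → Set
IsCycle n S ℓ vs =
  length vs ≡ ℓ × 3 ≤ ℓ × All (InSym n) vs × Unique vs × ClosedWalk (Adj S) vs

HasCycle : ℕ → List ℕ → ℕ → Set
HasCycle n S ℓ = ∃ λ vs → IsCycle n S ℓ vs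

S5 : ℕ → List ℕ
S5 n = (n Data.Nat.∸ 3) ∷ (n Data.Nat.∸ 1) ∷ n ∷ []
  where import Data.Nat

altA : List ℕ → ℕ → List ℕ
altB : List ℕ → ℕ → List ℕ
altA π zero = π
altA π (suc k) = altB (π ·r 5) k
altB π zero = π
altB π (suc k) = altA (π ·r 4) k

altWalk : List ℕ → List (List ℕ)
altWalk π = applyUpTo (altA π) 10

{-# OPTIONS --safe #-}
module Submission where

-- A 10-cycle π₀ π₁ … π₉ in P_n^5 spells a word w of ten generators with π₀ w = π₀, and w is
-- cyclically reduced because the generators are involutions and a cycle never backtracks.
-- As the entries of π₀ are distinct, w then fixes every position, so it suffices to show that
-- every cyclically reduced word of length 10 moves some position. For odd 7 ≤ n < 24 this is
-- checked by evaluation. For n ≥ 24, r_{n-3}, r_{n-1} and r_n reverse all but at most three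
-- entries, so they send a position at distance k ≤ 20 from one end of the list to a position
-- whose distance from one of the ends is independent of n; one symbolic computation per word
-- then finds a position that comes back to the same end at a different distance. For n = 5 the
-- alternating walk is computed on [0 1 2 3 4] and transported to any π by relabelling.

open import Data.Bool.Base using (Bool; true; false; T; _∧_; if_then_else_)
open import Data.Bool.Properties using (T-∧; T-≡)
open import Data.Empty using (⊥; ⊥-elim)
open import Data.List.Base
  using (List; []; _∷_; _++_; [_]; length; map; take; drop; reverse; applyUpTo)
open import Data.List.Properties
  using (length-++; length-reverse; length-take; length-applyUpTo; take++drop≡id; take-all; drop-all;
         reverse-involutive; unfold-reverse; ++-identityʳ; ∷-injectiveˡ; ∷-injectiveʳ; ≡-dec)
open import Data.List.Relation.Unary.All using (All; []; _∷_; all?)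
import Data.List.Relation.Unary.All.Properties as All
open import Data.List.Relation.Unary.AllPairs as AllPairs using (AllPairs; []; _∷_; allPairs?)
import Data.List.Relation.Unary.AllPairs.Properties as AllPairs
open import Data.List.Relation.Unary.Any using (Any; here; there; any?; satisfied)
open import Data.List.Relation.Unary.Linked as Linked using (Linked; []; [-]; _∷_; linked?)
open import Data.List.Relation.Unary.Unique.Propositional using (Unique)
open import Data.List.Relation.Unary.Unique.Propositional.Properties using (applyUpTo⁺₁)
open import Data.List.Relation.Binary.Permutation.Propositional
  using (_↭_; ↭-refl; ↭-sym; ↭-trans; ↭-reflexive; ↭⇒↭ₛ)
open import Data.List.Relation.Binary.Permutation.Propositional.Properties using (↭-length; ↭-reverse; ++⁺ʳ)
import Data.List.Relation.Binary.Permutation.Setoid.Properties as Permutationₛ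
open import Data.Maybe.Base using (Maybe; just; nothing; _>>=_)
import Data.Maybe.Relation.Unary.Any as Maybe
open import Data.Nat.Base
open import Data.Nat.Properties
open import Data.Nat.Tactic.RingSolver using (solve-∀)
open import Data.Product.Base using (Σ; ∃; ∃₂; _×_; _,_; proj₁; proj₂)
open import Data.Sum.Base using (_⊎_; inj₁; inj₂)
open import Function.Bundles using (Equivalence)
open import Function.Base using (_∘_)
open import Relation.Binary.PropositionalEquality hiding ([_])
open import Relation.Nullary.Decidable using (Dec; isYes; yes; no; ¬?; _×-dec_; _→-dec_; from-yes; toWitness)
open import Relation.Nullary.Negation using (¬_)
open import Relation.Nullary.Reflects using (Reflects; ofʸ; ofⁿ)
open import Defs

open import Algebra.Properties.CommutativeSemigroup +-commutativeSemigroup using (x∙yz≈y∙xz)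
open Permutationₛ (setoid ℕ) using (Unique-resp-↭)
open ≡-Reasoning

infixl 10 _‼_

-- Positions are counted from 0; beyond the end of the list the lookup returns the junk value 0.
_‼_ : List ℕ → ℕ → ℕ
[]       ‼ _     = 0
(x ∷ xs) ‼ zero  = x
(x ∷ xs) ‼ suc p = xs ‼ p

‼-++ˡ : ∀ xs ys {p} → p < length xs → (xs ++ ys) ‼ p ≡ xs ‼ p
‼-++ˡ (x ∷ xs) ys {zero}  _         = refl
‼-++ˡ (x ∷ xs) ys {suc p} (s<s p<n) = ‼-++ˡ xs ys p<n

‼-++ʳ : ∀ xs ys q → (xs ++ ys) ‼ (length xs + q) ≡ ys ‼ q
‼-++ʳ []       ys q = refl
‼-++ʳ (x ∷ xs) ys q = ‼-++ʳ xs ys q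

‼-take : ∀ i xs {p} → p < i → take i xs ‼ p ≡ xs ‼ p
‼-take (suc i) []       _                 = refl
‼-take (suc i) (x ∷ xs) {zero}  _         = refl
‼-take (suc i) (x ∷ xs) {suc p} (s<s p<i) = ‼-take i xs p<i

‼-drop : ∀ i xs q → drop i xs ‼ q ≡ xs ‼ (i + q)
‼-drop zero    xs       q = refl
‼-drop (suc i) []       q = refl
‼-drop (suc i) (x ∷ xs) q = ‼-drop i xs q

‼-reverse : ∀ xs {p} → p < length xs → reverse xs ‼ p ≡ xs ‼ (length xs ∸ suc p)
‼-reverse (x ∷ xs) {p} p<1+n rewrite unfold-reverse x xs with m≤n⇒m<n∨m≡n (s≤s⁻¹ p<1+n)
... | inj₁ p<n = begin
  (reverse xs ++ [ x ]) ‼ p  ≡⟨ ‼-++ˡ (reverse xs) _ (subst (p <_) (sym (length-reverse xs)) p<n) ⟩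
  reverse xs ‼ p             ≡⟨ ‼-reverse xs p<n ⟩
  xs ‼ (length xs ∸ suc p)   ≡⟨ cong ((x ∷ xs) ‼_) (+-∸-assoc 1 p<n) ⟨
  (x ∷ xs) ‼ (suc (length xs) ∸ suc p) ∎
... | inj₂ refl = begin
  (reverse xs ++ [ x ]) ‼ length xs                 ≡⟨ cong ((reverse xs ++ [ x ]) ‼_) |xs| ⟩
  (reverse xs ++ [ x ]) ‼ (length (reverse xs) + 0) ≡⟨ ‼-++ʳ (reverse xs) _ 0 ⟩
  x                                                 ≡⟨ cong ((x ∷ xs) ‼_) (n∸n≡0 (length xs)) ⟨
  (x ∷ xs) ‼ (length xs ∸ length xs) ∎
  where
  |xs| : length xs ≡ length (reverse xs) + 0
  |xs| = trans (sym (length-reverse xs)) (sym (+-identityʳ _))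

mirror : ℕ → ℕ → ℕ
mirror i p = if p <ᵇ i then i ∸ suc p else p

mirror-inside : ∀ {i p} → p < i → mirror i p ≡ i ∸ suc p
mirror-inside {i} {p} p<i with p <ᵇ i | <ᵇ-reflects-< p i
... | true  | ofʸ _   = refl
... | false | ofⁿ p≮i = ⊥-elim (p≮i p<i)

mirror-outside : ∀ {i p} → i ≤ p → mirror i p ≡ p
mirror-outside {i} {p} i≤p with p <ᵇ i | <ᵇ-reflects-< p i
... | true  | ofʸ p<i = ⊥-elim (<⇒≱ p<i i≤p)
... | false | ofⁿ _   = refl

mirror-inside-+ : ∀ {i p} → p < i → mirror i p + suc p ≡ i
mirror-inside-+ p<i = trans (cong (_+ _) (mirror-inside p<i)) (m∸n+n≡m p<i)

mirror-< : ∀ {n i p} → i ≤ n → p < n → mirror i p < n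
mirror-< {i = i} {p} i≤n p<n with p <? i
... | yes p<i = subst (_< _) (sym (mirror-inside p<i)) (<-≤-trans (∸-monoʳ-< z<s p<i) i≤n)
... | no  p≮i = subst (_< _) (sym (mirror-outside (≮⇒≥ p≮i))) p<n

length-·r : ∀ (π : List ℕ) i → length (π ·r i) ≡ length π
length-·r π i = begin
  length (reverse (take i π) ++ drop i π)          ≡⟨ length-++ (reverse (take i π)) ⟩
  length (reverse (take i π)) + length (drop i π)  ≡⟨ cong (_+ length (drop i π)) (length-reverse (take i π)) ⟩
  length (take i π) + length (drop i π)            ≡⟨ length-++ (take i π) ⟨
  length (take i π ++ drop i π)                    ≡⟨ cong length (take++drop≡id i π) ⟩
  length π                                         ∎

length-take-≤ : ∀ (π : List ℕ) {i} → i ≤ length π → length (take i π) ≡ i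
length-take-≤ π {i} i≤n = trans (length-take i π) (m≤n⇒m⊓n≡m i≤n)

‼-·r : ∀ (π : List ℕ) {i} p → i ≤ length π → (π ·r i) ‼ p ≡ π ‼ mirror i p
‼-·r π {i} p i≤n with p <? i
... | yes p<i = begin
  (reverse t ++ drop i π) ‼ p  ≡⟨ ‼-++ˡ (reverse t) _ (subst (p <_) (sym |rt|) p<i) ⟩
  reverse t ‼ p                ≡⟨ ‼-reverse t (subst (p <_) (sym |t|) p<i) ⟩
  t ‼ (length t ∸ suc p)       ≡⟨ cong (λ k → t ‼ (k ∸ suc p)) |t| ⟩
  t ‼ (i ∸ suc p)              ≡⟨ ‼-take i π (∸-monoʳ-< z<s p<i) ⟩
  π ‼ (i ∸ suc p)              ≡⟨ cong (π ‼_) (mirror-inside p<i) ⟨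
  π ‼ mirror i p               ∎
  where
  t = take i π
  |t| : length t ≡ i
  |t| = length-take-≤ π i≤n
  |rt| : length (reverse t) ≡ i
  |rt| = trans (length-reverse t) |t|
... | no p≮i = begin
  (reverse t ++ drop i π) ‼ p                        ≡⟨ cong ((reverse t ++ drop i π) ‼_) p≡ ⟩
  (reverse t ++ drop i π) ‼ (length (reverse t) + (p ∸ i)) ≡⟨ ‼-++ʳ (reverse t) _ (p ∸ i) ⟩
  drop i π ‼ (p ∸ i)                                 ≡⟨ ‼-drop i π (p ∸ i) ⟩
  π ‼ (i + (p ∸ i))                                  ≡⟨ cong (π ‼_) (m+[n∸m]≡n i≤p) ⟩
  π ‼ p                                              ≡⟨ cong (π ‼_) (mirror-outside i≤p) ⟨
  π ‼ mirror i p                                     ∎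
  where
  t = take i π
  i≤p = ≮⇒≥ p≮i
  p≡ : p ≡ length (reverse t) + (p ∸ i)
  p≡ = trans (sym (m+[n∸m]≡n i≤p))
             (cong (_+ (p ∸ i)) (sym (trans (length-reverse t) (length-take-≤ π i≤n))))

·r-prefix : ∀ xs ys {i} → length xs ≡ i → (xs ++ ys) ·r i ≡ reverse xs ++ ys
·r-prefix xs ys refl = cong₂ (λ t d → reverse t ++ d) (take-prefix xs) (drop-prefix xs)
  where
  take-prefix : ∀ xs → take (length xs) (xs ++ ys) ≡ xs
  take-prefix []       = refl
  take-prefix (x ∷ xs) = cong (x ∷_) (take-prefix xs)
  drop-prefix : ∀ xs → drop (length xs) (xs ++ ys) ≡ ys
  drop-prefix []       = refl
  drop-prefix (x ∷ xs) = drop-prefix xs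

·r-beyond : ∀ (π : List ℕ) {i} → length π ≤ i → π ·r i ≡ reverse π
·r-beyond π {i} n≤i rewrite take-all i π n≤i | drop-all i π n≤i = ++-identityʳ (reverse π)

·r-involutive : ∀ (π : List ℕ) i → (π ·r i) ·r i ≡ π
·r-involutive π i with i ≤? length π
... | yes i≤n = begin
  (reverse t ++ drop i π) ·r i  ≡⟨ ·r-prefix (reverse t) (drop i π) (trans (length-reverse t) (length-take-≤ π i≤n)) ⟩
  reverse (reverse t) ++ drop i π ≡⟨ cong (_++ drop i π) (reverse-involutive t) ⟩
  t ++ drop i π                 ≡⟨ take++drop≡id i π ⟩
  π                             ∎
  where t = take i π
... | no i≰n = begin
  (π ·r i) ·r i        ≡⟨ cong (_·r i) (·r-beyond π n≤i) ⟩
  reverse π ·r i       ≡⟨ ·r-beyond (reverse π) (subst (_≤ i) (sym (length-reverse π)) n≤i) ⟩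
  reverse (reverse π)  ≡⟨ reverse-involutive π ⟩
  π                    ∎
  where n≤i = <⇒≤ (≰⇒> i≰n)

·r-↭ : ∀ π i → π ·r i ↭ π
·r-↭ π i = ↭-trans (++⁺ʳ (drop i π) (↭-reverse (take i π))) (↭-reflexive (take++drop≡id i π))

All-‼ : ∀ {P : ℕ → Set} {xs p} → All P xs → p < length xs → P (xs ‼ p)
All-‼ {p = zero}  (px ∷ _)   _         = px
All-‼ {p = suc p} (_  ∷ pxs) (s<s p<n) = All-‼ pxs p<n

‼-injective : ∀ {xs p q} → Unique xs → p < length xs → q < length xs → xs ‼ p ≡ xs ‼ q → p ≡ q
‼-injective {p = zero}  {zero}  _          _         _         _  = refl
‼-injective {p = zero}  {suc q} (x∉xs ∷ _) _         (s<s q<n) eq = ⊥-elim (All-‼ x∉xs q<n eq)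
‼-injective {p = suc p} {zero}  (x∉xs ∷ _) (s<s p<n) _         eq = ⊥-elim (All-‼ x∉xs p<n (sym eq))
‼-injective {p = suc p} {suc q} (_ ∷ xs!)  (s<s p<n) (s<s q<n) eq = cong suc (‼-injective xs! p<n q<n eq)

InSym⇒length : ∀ {n π} → InSym n π → length π ≡ n
InSym⇒length {n} π↭ = trans (↭-length π↭) (length-applyUpTo suc n)

InSym⇒Unique : ∀ {n π} → InSym n π → Unique π
InSym⇒Unique {n} π↭ =
  Unique-resp-↭ (↭⇒↭ₛ (↭-sym π↭)) (applyUpTo⁺₁ suc n (λ i<j _ → <⇒≢ i<j ∘ suc-injective))

data Gen : Set where
  r[n-3] r[n-1] r[n] : Gen

deficit : Gen → ℕ
deficit r[n-3] = 3
deficit r[n-1] = 1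
deficit r[n]   = 0

deficit≤3 : ∀ g → deficit g ≤ 3
deficit≤3 r[n-3] = ≤-refl
deficit≤3 r[n-1] = s≤s z≤n
deficit≤3 r[n]   = z≤n

act : ℕ → List ℕ → List Gen → List ℕ
act n π []      = π
act n π (g ∷ w) = act n (π ·r (n ∸ deficit g)) w

track : ℕ → List Gen → ℕ → ℕ
track n []      p = p
track n (g ∷ w) p = mirror (n ∸ deficit g) (track n w p)

‼-act : ∀ {n} π w p → length π ≡ n → act n π w ‼ p ≡ π ‼ track n w p
‼-act         π []      p _   = refl
‼-act {n = n} π (g ∷ w) p |π| = begin
  act n (π ·r i) w ‼ p      ≡⟨ ‼-act (π ·r i) w p (trans (length-·r π i) |π|) ⟩
  (π ·r i) ‼ track n w p    ≡⟨ ‼-·r π (track n w p) (subst (i ≤_) (sym |π|) (m∸n≤m n (deficit g))) ⟩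
  π ‼ mirror i (track n w p) ∎
  where i = n ∸ deficit g

track-< : ∀ {n} w {p} → p < n → track n w p < n
track-<         []      p<n = p<n
track-< {n = n} (g ∷ w) p<n = mirror-< (m∸n≤m n (deficit g)) (track-< w p<n)

track-fixed : ∀ {n π} w {p} → InSym n π → act n π w ≡ π → p < n → track n w p ≡ p
track-fixed {n} {π} w {p} π∈ closes p<n =
  sym (‼-injective (InSym⇒Unique π∈) (at p<n) (at (track-< w p<n)) (begin
    π ‼ p            ≡⟨ cong (_‼ p) closes ⟨
    act n π w ‼ p    ≡⟨ ‼-act π w p (InSym⇒length π∈) ⟩
    π ‼ track n w p  ∎))
  where
  at : ∀ {q} → q < n → q < length π
  at = subst (_ <_) (sym (InSym⇒length π∈))

Moves : ℕ → List Gen → Set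
Moves n w = ∃ λ p → p < n × track n w p ≢ p

Moves⇒act≢ : ∀ {n π} w → InSym n π → Moves n w → act n π w ≢ π
Moves⇒act≢ w π∈ (p , p<n , moved) closes = moved (track-fixed w π∈ closes p<n)

-- A 10-cycle spells a closed cyclically reduced word

Step : ℕ → List ℕ → List ℕ → Set
Step n π σ = Σ Gen λ g → σ ≡ π ·r (n ∸ deficit g)

·r-edge : ∀ {π σ} i → σ ≡ π ·r i ⊎ π ≡ σ ·r i → σ ≡ π ·r i
·r-edge         i (inj₁ σ≡π·r) = σ≡π·r
·r-edge {σ = σ} i (inj₂ refl)  = sym (·r-involutive σ i)

Adj⇒Step : ∀ {n π σ} → Adj (S5 n) π σ → Step n π σ
Adj⇒Step {n} (_ , here refl                 , edge) = r[n-3] , ·r-edge (n ∸ 3) edge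
Adj⇒Step {n} (_ , there (here refl)         , edge) = r[n-1] , ·r-edge (n ∸ 1) edge
Adj⇒Step {n} (_ , there (there (here refl)) , edge) = r[n]   , ·r-edge n edge

labels-differ : ∀ {n π σ τ} → π ≢ τ → (a : Step n π σ) (b : Step n σ τ) → proj₁ a ≢ proj₁ b
labels-differ {n} {π} π≢τ (g , refl) (.g , refl) refl = π≢τ (sym (·r-involutive π (n ∸ deficit g)))

walkWord : ∀ {n xs} → Linked (Step n) xs → List Gen
walkWord []               = []
walkWord [-]              = []
walkWord ((g , _) ∷ walk) = g ∷ walkWord walk

act-walkWord : ∀ {n π σ} xs (walk : Linked (Step n) (π ∷ xs ++ [ σ ])) → act n π (walkWord walk) ≡ σ
act-walkWord []       ((_ , refl) ∷ [-])  = refl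
act-walkWord (_ ∷ xs) ((_ , refl) ∷ walk) = act-walkWord xs walk

CyclicallyReduced : List Gen → Set
CyclicallyReduced w = Linked _≢_ (w ++ take 1 w)

10-cycle-reduced : ∀ {n v₀ v₁ v₂ v₃ v₄ v₅ v₆ v₇ v₈ v₉} →
  Unique (v₀ ∷ v₁ ∷ v₂ ∷ v₃ ∷ v₄ ∷ v₅ ∷ v₆ ∷ v₇ ∷ v₈ ∷ v₉ ∷ []) →
  (walk : Linked (Step n) (v₀ ∷ v₁ ∷ v₂ ∷ v₃ ∷ v₄ ∷ v₅ ∷ v₆ ∷ v₇ ∷ v₈ ∷ v₉ ∷ v₀ ∷ [])) →
  length (walkWord walk) ≡ 10 × CyclicallyReduced (walkWord walk)
10-cycle-reduced
  ((_ ∷ v₀≢v₂ ∷ _ ∷ _ ∷ _ ∷ _ ∷ _ ∷ v₀≢v₈ ∷ _ ∷ []) ∷ (_ ∷ v₁≢v₃ ∷ _ ∷ _ ∷ _ ∷ _ ∷ _ ∷ v₁≢v₉ ∷ []) ∷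
   (_ ∷ v₂≢v₄ ∷ _) ∷ (_ ∷ v₃≢v₅ ∷ _) ∷ (_ ∷ v₄≢v₆ ∷ _) ∷ (_ ∷ v₅≢v₇ ∷ _) ∷ (_ ∷ v₆≢v₈ ∷ _) ∷ (_ ∷ v₇≢v₉ ∷ _) ∷ _)
  (a₀ ∷ a₁ ∷ a₂ ∷ a₃ ∷ a₄ ∷ a₅ ∷ a₆ ∷ a₇ ∷ a₈ ∷ a₉ ∷ [-]) = refl ,
  labels-differ v₀≢v₂ a₀ a₁ ∷ labels-differ v₁≢v₃ a₁ a₂ ∷ labels-differ v₂≢v₄ a₂ a₃ ∷
  labels-differ v₃≢v₅ a₃ a₄ ∷ labels-differ v₄≢v₆ a₄ a₅ ∷ labels-differ v₅≢v₇ a₅ a₆ ∷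
  labels-differ v₆≢v₈ a₆ a₇ ∷ labels-differ v₇≢v₉ a₇ a₈ ∷ labels-differ (≢-sym v₀≢v₈) a₈ a₉ ∷
  labels-differ (≢-sym v₁≢v₉) a₉ a₀ ∷ [-]

10-cycle⇒closed-word : ∀ {n} vs → IsCycle n (S5 n) 10 vs →
  ∃₂ λ π w → InSym n π × length w ≡ 10 × CyclicallyReduced w × act n π w ≡ π
10-cycle⇒closed-word (v₀ ∷ vs@(_ ∷ _ ∷ _ ∷ _ ∷ _ ∷ _ ∷ _ ∷ _ ∷ _ ∷ [])) (refl , _ , π∈ ∷ _ , distinct , closed)
  with walk ← Linked.map Adj⇒Step closed
  with |w| , reduced ← 10-cycle-reduced distinct walk
  = v₀ , walkWord walk , π∈ , |w| , reduced , act-walkWord vs walk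

-- Symbolic positions near the ends of a long list

data SymPos : Set where
  fromStart fromEnd : ℕ → SymPos

offset : SymPos → ℕ
offset (fromStart k) = k
offset (fromEnd k)   = k

Denotes : ℕ → SymPos → ℕ → Set
Denotes n (fromStart k) p = p ≡ k
Denotes n (fromEnd k)   p = suc (p + k) ≡ n

mirrorˢ : ℕ → SymPos → SymPos
mirrorˢ j (fromStart k) = fromEnd (k + j)
mirrorˢ j (fromEnd k)   = if j ≤ᵇ k then fromStart (k ∸ j) else fromEnd k

-- Offsets are kept at most 20, which makes every symbolic step exact as soon as n ≥ 24.
trackˢ : List Gen → SymPos → Maybe SymPos
trackˢ []      s = just s
trackˢ (g ∷ w) s = trackˢ w s >>= λ t →
  if offset t ≤ᵇ 20 then just (mirrorˢ (deficit g) t) else nothing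

Apart : SymPos → SymPos → Set
Apart (fromStart k) (fromStart l) = k ≢ l
Apart (fromStart _) (fromEnd _)   = ⊥
Apart (fromEnd _)   (fromStart _) = ⊥
Apart (fromEnd k)   (fromEnd l)   = k ≢ l

Separates : List Gen → SymPos → Set
Separates w s = offset s ≤ 20 × Maybe.Any (Apart s) (trackˢ w s)

suc-shuffle : ∀ q k j → q + suc k + j ≡ suc (q + (k + j))
suc-shuffle = solve-∀

module _ {n : ℕ} (24≤n : 24 ≤ n) where

  offset<n : ∀ {k} → k ≤ 20 → k < n
  offset<n k≤20 = <-≤-trans (s≤s (≤-trans k≤20 (m≤m+n 20 3))) 24≤n

  offset+deficit<n : ∀ {k j} → k ≤ 20 → j ≤ 3 → k + j < n
  offset+deficit<n k≤20 j≤3 = <-≤-trans (s≤s (+-mono-≤ k≤20 j≤3)) 24≤n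

  n∸j+j≡n : ∀ {j} → j ≤ 3 → n ∸ j + j ≡ n
  n∸j+j≡n j≤3 = m∸n+n≡m (≤-trans j≤3 (≤-trans (m≤m+n 3 21) 24≤n))

  mirror-∸-inside : ∀ {j p} → j ≤ 3 → p + j < n → suc (mirror (n ∸ j) p + (p + j)) ≡ n
  mirror-∸-inside {j} {p} j≤3 p+j<n = begin
    suc (mirror i p + (p + j))  ≡⟨ suc-shuffle (mirror i p) p j ⟨
    mirror i p + suc p + j      ≡⟨ cong (_+ j) (mirror-inside-+ p<i) ⟩
    i + j                       ≡⟨ n∸j+j≡n j≤3 ⟩
    n                           ∎
    where
    i = n ∸ j
    p<i = +-cancelʳ-< j p i (subst (p + j <_) (sym (n∸j+j≡n j≤3)) p+j<n)

  mirror-∸-outside : ∀ {j p} → j ≤ 3 → n ≤ p + j → mirror (n ∸ j) p ≡ p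
  mirror-∸-outside {j} {p} j≤3 n≤p+j =
    mirror-outside (+-cancelʳ-≤ j (n ∸ j) p (subst (_≤ p + j) (sym (n∸j+j≡n j≤3)) n≤p+j))

  mirrorˢ-sound : ∀ {j} → j ≤ 3 → ∀ s {p} → offset s ≤ 20 →
                  Denotes n s p → Denotes n (mirrorˢ j s) (mirror (n ∸ j) p)
  mirrorˢ-sound j≤3 (fromStart k) k≤20 refl = mirror-∸-inside j≤3 (offset+deficit<n k≤20 j≤3)
  mirrorˢ-sound {j} j≤3 (fromEnd k) {p} _ p+k+1≡n = fromEnd-case (j ≤ᵇ k) (≤ᵇ-reflects-≤ j k)
    where
    q = mirror (n ∸ j) p
    fromEnd-case : ∀ b → Reflects (j ≤ k) b → Denotes n (if b then fromStart (k ∸ j) else fromEnd k) q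
    fromEnd-case true (ofʸ j≤k) = begin
      q          ≡⟨ m+n∸n≡m q j ⟨
      q + j ∸ j  ≡⟨ cong (_∸ j) q+j≡k ⟩
      k ∸ j      ∎
      where
      p+j<n = subst (p + j <_) p+k+1≡n (s≤s (+-monoʳ-≤ p j≤k))
      q+j≡k : q + j ≡ k
      q+j≡k = +-cancelˡ-≡ p _ _ (suc-injective (begin
        suc (p + (q + j))  ≡⟨ cong suc (x∙yz≈y∙xz p q j) ⟩
        suc (q + (p + j))  ≡⟨ mirror-∸-inside j≤3 p+j<n ⟩
        n                  ≡⟨ p+k+1≡n ⟨
        suc (p + k)        ∎))
    fromEnd-case false (ofⁿ j≰k) =
      trans (cong (λ q → suc (q + k)) (mirror-∸-outside j≤3 n≤p+j)) p+k+1≡n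
      where n≤p+j = subst (_≤ p + j) p+k+1≡n (+-monoʳ-< p (≰⇒> j≰k))

  trackˢ-sound : ∀ w {s t p} → trackˢ w s ≡ just t → Denotes n s p → Denotes n t (track n w p)
  trackˢ-sound []      refl s≈p = s≈p
  trackˢ-sound (g ∷ w) {s} eq s≈p with trackˢ w s in eqʷ
  trackˢ-sound (g ∷ w) ()   s≈p | nothing
  trackˢ-sound (g ∷ w) eq   s≈p | just u with offset u ≤ᵇ 20 | ≤ᵇ-reflects-≤ (offset u) 20
  trackˢ-sound (g ∷ w) refl s≈p | just u | true  | ofʸ u≤20 =
    mirrorˢ-sound (deficit≤3 g) u u≤20 (trackˢ-sound w eqʷ s≈p)
  trackˢ-sound (g ∷ w) ()   s≈p | just u | false | _

  Apart-sound : ∀ s t {p q} → Apart s t → Denotes n s p → Denotes n t q → p ≢ q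
  Apart-sound (fromStart k) (fromStart l) k≢l refl refl = k≢l
  Apart-sound (fromEnd k)   (fromEnd l) {p} k≢l p+k+1≡n p+l+1≡n refl =
    k≢l (+-cancelˡ-≡ p k l (suc-injective (trans p+k+1≡n (sym p+l+1≡n))))

  realise : ∀ s → offset s ≤ 20 → ∃ λ p → p < n × Denotes n s p
  realise (fromStart k) k≤20 = k , offset<n k≤20 , refl
  realise (fromEnd k)   k≤20 =
    n ∸ suc k , ∸-monoʳ-< z<s (offset<n k≤20) , trans (sym (+-suc _ k)) (m∸n+n≡m (offset<n k≤20))

  Separates⇒Moves : ∀ w s → Separates w s → Moves n w
  Separates⇒Moves w s (s≤20 , apart) with trackˢ w s in eq
  Separates⇒Moves w s (_    , ())    | nothing
  Separates⇒Moves w s (s≤20 , apart) | just t with p , p<n , s≈p ← realise s s≤20 =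
    p , p<n , ≢-sym (Apart-sound s t (Maybe.drop-just apart) s≈p (trackˢ-sound w eq s≈p))

-- Every cyclically reduced word of length 10 moves a position

_≟ᵍ_ : (g h : Gen) → Dec (g ≡ h)
r[n-3] ≟ᵍ r[n-3] = yes refl
r[n-3] ≟ᵍ r[n-1] = no λ ()
r[n-3] ≟ᵍ r[n]   = no λ ()
r[n-1] ≟ᵍ r[n-3] = no λ ()
r[n-1] ≟ᵍ r[n-1] = yes refl
r[n-1] ≟ᵍ r[n]   = no λ ()
r[n]   ≟ᵍ r[n-3] = no λ ()
r[n]   ≟ᵍ r[n-1] = no λ ()
r[n]   ≟ᵍ r[n]   = yes refl

T-∧⁻ : ∀ x {y} → T (x ∧ y) → T x × T y
T-∧⁻ x = Equivalence.to (T-∧ {x})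

everyGen : (Gen → Bool) → Bool
everyGen h = h r[n-3] ∧ h r[n-1] ∧ h r[n]

everyGen-sound : ∀ h → T (everyGen h) → ∀ g → T (h g)
everyGen-sound h holds r[n-3] = proj₁ (T-∧⁻ (h r[n-3]) holds)
everyGen-sound h holds r[n-1] = proj₁ (T-∧⁻ (h r[n-1]) (proj₂ (T-∧⁻ (h r[n-3]) holds)))
everyGen-sound h holds r[n]   = proj₂ (T-∧⁻ (h r[n-1]) (proj₂ (T-∧⁻ (h r[n-3]) holds)))

everyWord : ℕ → (List Gen → Bool) → Bool
everyWord zero    f = f []
everyWord (suc k) f = everyGen (λ g → everyWord k (f ∘ (g ∷_)))

everyWord-sound : ∀ k f → T (everyWord k f) → ∀ w → length w ≡ k → T (f w)
everyWord-sound zero    f holds []      refl = holds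
everyWord-sound (suc k) f holds (g ∷ w) refl =
  everyWord-sound k (f ∘ (g ∷_)) (everyGen-sound (λ g → everyWord k (f ∘ (g ∷_))) holds g) w refl

cyclicallyReduced? : ∀ w → Dec (CyclicallyReduced w)
cyclicallyReduced? w = linked? (λ g h → ¬? (g ≟ᵍ h)) (w ++ take 1 w)

moves? : ∀ n w → Dec (Moves n w)
moves? n w = anyUpTo? (λ p → ¬? (track n w p ≟ p)) n

SmallOddMoves : List Gen → Set
SmallOddMoves w = ∀ {n} → n < 24 → 7 ≤ n → n % 2 ≡ 1 → Moves n w

smallOddMoves? : ∀ w → Dec (SmallOddMoves w)
smallOddMoves? w = allUpTo? (λ n → 7 ≤? n →-dec (n % 2 ≟ 1 →-dec moves? n w)) 24

-- Offsets below 7 turn out to suffice for every word.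
startPositions : List SymPos
startPositions = applyUpTo fromStart 7 ++ applyUpTo fromEnd 7

apart? : ∀ s t → Dec (Apart s t)
apart? (fromStart k) (fromStart l) = ¬? (k ≟ l)
apart? (fromStart _) (fromEnd _)   = no λ ()
apart? (fromEnd _)   (fromStart _) = no λ ()
apart? (fromEnd k)   (fromEnd l)   = ¬? (k ≟ l)

separates? : ∀ w s → Dec (Separates w s)
separates? w s = offset s ≤? 20 ×-dec Maybe.dec (apart? s) (trackˢ w s)

Certificate : List Gen → Set
Certificate w = CyclicallyReduced w → SmallOddMoves w × Any (Separates w) startPositions

certificate? : ∀ w → Dec (Certificate w)
certificate? w =
  cyclicallyReduced? w →-dec (smallOddMoves? w ×-dec any? (separates? w) startPositions)

every-word-certified : everyWord 10 (isYes ∘ certificate?) ≡ true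
every-word-certified = refl

certified : ∀ w → length w ≡ 10 → Certificate w
certified w |w| = toWitness {a? = certificate? w}
  (everyWord-sound 10 (isYes ∘ certificate?) (Equivalence.from T-≡ every-word-certified) w |w|)

reduced-word-moves : ∀ {n} w → 7 ≤ n → n % 2 ≡ 1 → length w ≡ 10 → CyclicallyReduced w → Moves n w
reduced-word-moves {n} w 7≤n odd |w| reduced
  with small , separating ← certified w |w| reduced
  with n <? 24
... | yes n<24 = small n<24 7≤n odd
... | no  n≮24 with s , separates ← satisfied separating = Separates⇒Moves (≮⇒≥ n≮24) w s separates

no-10-cycle : ∀ {n} → 7 ≤ n → n % 2 ≡ 1 → ¬ HasCycle n (S5 n) 10
no-10-cycle 7≤n odd (vs , cycle) with π , w , π∈ , |w| , reduced , closes ← 10-cycle⇒closed-word vs cycle =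
  Moves⇒act≢ w π∈ (reduced-word-moves w 7≤n odd |w| reduced) closes

-- The alternating 10-cycle in P_5^5

altA-↭ : ∀ k π → altA π k ↭ π
altB-↭ : ∀ k π → altB π k ↭ π
altA-↭ zero    π = ↭-refl
altA-↭ (suc k) π = ↭-trans (altB-↭ k (π ·r 5)) (·r-↭ π 5)
altB-↭ zero    π = ↭-refl
altB-↭ (suc k) π = ↭-trans (altA-↭ k (π ·r 4)) (·r-↭ π 4)

map-‼-injective : ∀ {ρ σ τ} → Unique ρ → All (_< length ρ) σ → All (_< length ρ) τ →
                  map (ρ ‼_) σ ≡ map (ρ ‼_) τ → σ ≡ τ
map-‼-injective ρ! []         []         _  = refl
map-‼-injective ρ! (x< ∷ σ<) (y< ∷ τ<) eq =
  cong₂ _∷_ (‼-injective ρ! x< y< (∷-injectiveˡ eq)) (map-‼-injective ρ! σ< τ< (∷-injectiveʳ eq))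

ι₅ : List ℕ
ι₅ = 0 ∷ 1 ∷ 2 ∷ 3 ∷ 4 ∷ []

altWalk-ι₅-separated : AllPairs (λ σ τ → σ ≢ τ × All (_< 5) σ × All (_< 5) τ) (altWalk ι₅)
altWalk-ι₅-separated = from-yes (allPairs? separated? (altWalk ι₅))
  where
  separated? = λ σ τ → ¬? (≡-dec _≟_ σ τ) ×-dec all? (_<? 5) σ ×-dec all? (_<? 5) τ

r₅-edge : ∀ {σ} → Adj (S5 5) σ (σ ·r 5)
r₅-edge = 5 , there (there (here refl)) , inj₁ refl

r₄-edge : ∀ {σ} → Adj (S5 5) σ (σ ·r 4)
r₄-edge = 4 , there (here refl) , inj₁ refl

altWalk-10-cycle : ∀ π → InSym 5 π → (altA π 10 ≡ π) × IsCycle 5 (S5 5) 10 (altWalk π)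
altWalk-10-cycle π π∈ = of-length-5 π π∈ (InSym⇒length π∈)
  where
  -- For a list π of five variables, altWalk π and map (map (π ‼_)) (altWalk ι₅) have the same
  -- normal form, which is what makes the relabelling below typecheck.
  of-length-5 : ∀ π → InSym 5 π → length π ≡ 5 → (altA π 10 ≡ π) × IsCycle 5 (S5 5) 10 (altWalk π)
  of-length-5 π@(_ ∷ _ ∷ _ ∷ _ ∷ _ ∷ []) π∈ refl =
    refl , refl , s≤s (s≤s (s≤s z≤n)) ,
    All.applyUpTo⁺₂ (altA π) 10 (λ k → ↭-trans (altA-↭ k π) π∈) ,
    AllPairs.map⁺ (AllPairs.map relabel altWalk-ι₅-separated) ,
    r₅-edge ∷ r₄-edge ∷ r₅-edge ∷ r₄-edge ∷ r₅-edge ∷ r₄-edge ∷ r₅-edge ∷ r₄-edge ∷ r₅-edge ∷ r₄-edge ∷ [-]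
    where
    relabel : ∀ {σ τ} → σ ≢ τ × All (_< 5) σ × All (_< 5) τ → map (π ‼_) σ ≢ map (π ‼_) τ
    relabel (σ≢τ , σ< , τ<) = σ≢τ ∘ map-‼-injective (InSym⇒Unique π∈) σ< τ<

theorem4 : (n : ℕ) → 5 ≤ n → n % 2 ≡ 1 →
    (7 ≤ n → ¬ HasCycle n (S5 n) 10) ×
    (n ≡ 5 →
      HasCycle 5 (S5 5) 10 ×
      ((π : List ℕ) → InSym 5 π → (altA π 10 ≡ π) × IsCycle 5 (S5 5) 10 (altWalk π)))
theorem4 n _ odd =
  (λ 7≤n → no-10-cycle 7≤n odd) ,
  (λ _ → (altWalk (OneToN 5) , proj₂ (altWalk-10-cycle (OneToN 5) ↭-refl)) , altWalk-10-cycle)
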